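{- For every positive integer $m$, let $\mathrm{O2}(m)$ denote the number of partitions of $m$ in which no odd part is repeated, the largest part is even, and the largest part appears at least twice; and let $\mathrm{pod}_{>2}(m)$ denote the number of partitions of $m$ in which no odd part is repeated and every part is strictly greater than $2$. Then for all integers $n>4$, \[ \mathrm{O2}(n)+\mathrm{O2}(n-3)=\mathrm{pod}_{>2}(n). \]
   Context: A partition of $m$ is a finite non-increasing sequence of positive integers $\lambda_1\ge \lambda_2\ge\cdots\ge\lambda_k$ with sum $m$; its parts are the $\lambda_i$ and its largest part is $\lambda_1$. "No odd part is repeated" means every odd integer occurs at most once among the parts (even parts may repeat). -}

module Defs where

open import Data.Nat using (ℕ; zero; suc; _+_; _∸_; _≤_; _<_; _≤?_; _<?_; _≟_)
open import Data.Nat.Base using (_%_)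
open import Data.List using (List; []; _∷_; length; filter; map; concatMap; upTo)
open import Data.Nat.ListAction using (sum)
open import Data.List.Relation.Unary.All using (All)
open import Data.List.Relation.Unary.AllPairs using (AllPairs)
open import Data.Product using (_×_)
open import Relation.Binary.PropositionalEquality using (_≡_)
open import Relation.Nullary using (¬_)
open import Relation.Nullary.Decidable using (Dec; _×-dec_; ¬?; _→-dec_)
open import Data.List.Relation.Unary.All using (all?)
open import Data.List.Relation.Unary.AllPairs using (allPairs?)
open import Relation.Unary using (Pred; Decidable)
open import Data.Bool using (Bool; true; false)
open import Level using (0ℓ)

Odd : ℕ → Set
Odd n = n % 2 ≡ 1

Even : ℕ → Set
Even n = n % 2 ≡ 0

IsPartition : ℕ → List ℕ → Set
IsPartition m xs = AllPairs (λ a b → b ≤ a) xs × All (λ a → 0 < a) xs × sum xs ≡ m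

NoOddRepeated : List ℕ → Set
NoOddRepeated xs = AllPairs (λ a b → Odd a → ¬ (a ≡ b)) xs

LargestEvenTwice : List ℕ → Set
LargestEvenTwice [] = Data.Empty.⊥ where import Data.Empty
LargestEvenTwice (a ∷ []) = Data.Empty.⊥ where import Data.Empty
LargestEvenTwice (a ∷ b ∷ xs) = Even a × a ≡ b

AllPartsGt2 : List ℕ → Set
AllPartsGt2 xs = All (λ a → 2 < a) xs

-- Enumeration of all lists of positive integers, non-increasing, with parts ≤ k, summing to m.
-- (fuel = m; every such list has length ≤ m)
partsLe : ℕ → ℕ → ℕ → List (List ℕ)
partsLe zero    k zero    = [] ∷ []
partsLe zero    k (suc m) = []
partsLe (suc f) k zero    = [] ∷ []
partsLe (suc f) k (suc m) =
  concatMap (λ a → map (a ∷_) (partsLe f a (suc m ∸ a)))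
            (filter (λ a → (1 ≤? a) ×-dec (a ≤? k) ×-dec (a ≤? suc m)) (upTo (suc (suc m))))

partitions : ℕ → List (List ℕ)
partitions m = partsLe m m m

#Partitions : {P : Pred (List ℕ) 0ℓ} → Decidable P → ℕ → ℕ
#Partitions P? m = length (filter P? (partitions m))

odd? : (n : ℕ) → Dec (Odd n)
odd? n = n % 2 ≟ 1

even? : (n : ℕ) → Dec (Even n)
even? n = n % 2 ≟ 0

noOddRepeated? : (xs : List ℕ) → Dec (NoOddRepeated xs)
noOddRepeated? = allPairs? (λ a b → odd? a →-dec ¬? (a ≟ b))
  where import Relation.Nullary.Decidable

largestEvenTwice? : (xs : List ℕ) → Dec (LargestEvenTwice xs)
largestEvenTwice? [] = Relation.Nullary.no (λ ())
largestEvenTwice? (a ∷ []) = Relation.Nullary.no (λ ())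
largestEvenTwice? (a ∷ b ∷ xs) = even? a ×-dec (a ≟ b)

allPartsGt2? : (xs : List ℕ) → Dec (AllPartsGt2 xs)
allPartsGt2? = all? (λ a → 2 <? a)

O2? : (xs : List ℕ) → Dec (NoOddRepeated xs × LargestEvenTwice xs)
O2? xs = noOddRepeated? xs ×-dec largestEvenTwice? xs

pod>2? : (xs : List ℕ) → Dec (NoOddRepeated xs × AllPartsGt2 xs)
pod>2? xs = noOddRepeated? xs ×-dec allPartsGt2? xs

O2 : ℕ → ℕ
O2 = #Partitions O2?

pod>2 : ℕ → ℕ
pod>2 = #Partitions pod>2?

_ : length (partitions 5) ≡ 7
_ = Relation.Binary.PropositionalEquality.refl
  where import Relation.Binary.PropositionalEquality

-- Write pod≤ k, pod>2≤ k and O2≤ k for the generating functions of the partitions counted by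
-- pod, pod>2 and O2 whose parts are at most k. Splitting off the largest part a gives
--   pod≤ a = (1 + q^a) pod≤ (a − 1) for odd a,  pod≤ a = pod≤ (a − 1) + q^a pod≤ a for even a,
--   O2≤ a = O2≤ (a − 1) + q^(2a) pod≤ a for even a,  O2≤ a = O2≤ (a − 1) for odd a,
-- since removing two copies of an even largest part a leaves an arbitrary partition with parts ≤ a.
-- Induction over even E then gives
--   (1 + q³)(1 + O2≤ E) + q pod≤ E = (1 + q^(E+1) + q^(2E+3)) pod≤ E,
-- whose last two terms do not reach qⁿ once E ≥ n. As the parts 1 and 2 contribute 1 / (1 − q),
-- also pod = pod>2 + q pod. Comparing coefficients of qⁿ and cancelling pod(n − 1) gives the theorem.
module Submission where

open import Defs
open import Data.Nat using (ℕ; _+_; _∸_; _<_)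
open import Relation.Binary.PropositionalEquality using (_≡_)

open import Level using (Level; 0ℓ)
open import Function using (_∘_; const)
open import Function.Bundles using (_⇔_; mk⇔; Equivalence)
open import Data.Nat using (zero; suc; _*_; _≤_; _⊓_; z≤n; s≤s)
open import Data.Nat.Properties
open import Data.Nat.Induction using (<-rec)
open import Data.Nat.DivMod using (m*n%n≡0)
open import Data.Nat.Tactic.RingSolver using (solve-∀)
open import Algebra.Properties.CommutativeSemigroup +-commutativeSemigroup using (interchange; xy∙z≈xz∙y)
open import Data.List using (List; []; _∷_; _++_; [_]; length; filter; map; concatMap; upTo; applyUpTo)
open import Data.List.Properties
  using ( length-++; ++-identityʳ; filter-++; filter-accept; filter-reject; filter-≐; filter-none
        ; upTo-∷ʳ; applyUpTo-∷ʳ; map-upTo; concatMap-map; concatMap-cong; concatMap-++ )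
open import Data.List.Relation.Unary.All as All using (All; []; _∷_; all?)
open import Data.List.Relation.Unary.All.Properties using (all-filter; concat⁺; map⁺)
open import Data.List.Relation.Unary.AllPairs using (_∷_)
open import Data.Product using (_×_; _,_; proj₂)
open import Data.Sum using (_⊎_; inj₁; inj₂)
open import Data.Unit using (tt)
open import Data.Bool using (true; false)
open import Relation.Binary.PropositionalEquality using (refl; sym; trans; cong; cong₂; _≗_; module ≡-Reasoning)
open import Relation.Nullary using (¬_; Dec; yes; no; does; contradiction)
open import Relation.Nullary.Decidable using (_×-dec_)
open import Relation.Unary using (Pred; Decidable; U; ∁)
open import Relation.Unary.Properties using (U?)

private
  variable
    ℓ ℓ₁ ℓ₂ : Level
    A : Set ℓ
    k m n b : ℕ
    xs : List ℕ
    f g : ℕ → ℕ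

infixl 6 _⊕_

-- A sequence f : ℕ → ℕ stands for the power series Σ f(n) qⁿ: δ is 1, _⊕_ is addition and
-- shift d f is q^d · f.
_⊕_ : (ℕ → ℕ) → (ℕ → ℕ) → ℕ → ℕ
(f ⊕ g) n = f n + g n

δ : ℕ → ℕ
δ zero    = 1
δ (suc _) = 0

shift : ℕ → (ℕ → ℕ) → ℕ → ℕ
shift zero    f n       = f n
shift (suc d) f zero    = 0
shift (suc d) f (suc n) = shift d f n

shift-≤ : ∀ d → d ≤ n → shift d f n ≡ f (n ∸ d)
shift-≤ zero    _         = refl
shift-≤ (suc d) (s≤s d≤n) = shift-≤ d d≤n

shift-> : ∀ d → n < d → shift d f n ≡ 0
shift-> {zero}  (suc d) _         = refl
shift-> {suc n} (suc d) (s≤s n<d) = shift-> d n<d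

shift-cong-≤ : ∀ d n → (∀ {m} → m ≤ n → f m ≡ g m) → shift d f n ≡ shift d g n
shift-cong-≤ zero    n       f≡g = f≡g ≤-refl
shift-cong-≤ (suc d) zero    f≡g = refl
shift-cong-≤ (suc d) (suc n) f≡g = shift-cong-≤ d n (f≡g ∘ m≤n⇒m≤1+n)

shift-cong : ∀ d → f ≗ g → shift d f ≗ shift d g
shift-cong d f≗g n = shift-cong-≤ d n (λ {m} _ → f≗g m)

shift-⊕ : ∀ d → shift d (f ⊕ g) ≗ shift d f ⊕ shift d g
shift-⊕ zero    n       = refl
shift-⊕ (suc d) zero    = refl
shift-⊕ (suc d) (suc n) = shift-⊕ d n

shift-shift : ∀ d e → shift d (shift e f) ≗ shift (d + e) f
shift-shift zero    e n       = refl
shift-shift (suc d) e zero    = refl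
shift-shift (suc d) e (suc n) = shift-shift d e n

shift-comm : ∀ d e → shift d (shift e f) ≗ shift e (shift d f)
shift-comm {f = f} d e n = begin
  shift d (shift e f) n ≡⟨ shift-shift d e n ⟩
  shift (d + e) f n     ≡⟨ cong (λ s → shift s f n) (+-comm d e) ⟩
  shift (e + d) f n     ≡⟨ shift-shift e d n ⟨
  shift e (shift d f) n ∎
  where open ≡-Reasoning

shift-⊕-shift : ∀ e d {h : ℕ → ℕ} → shift e (f ⊕ shift d h) ≗ shift e f ⊕ shift (e + d) h
shift-⊕-shift e d n = trans (shift-⊕ e n) (cong (shift e _ n +_) (shift-shift e d n))

shift-const-0 : ∀ d → shift d (const 0) ≗ const 0
shift-const-0 zero    n       = refl
shift-const-0 (suc d) zero    = refl
shift-const-0 (suc d) (suc n) = shift-const-0 d n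

-- Division by 1 − q^(1+d) is well defined.
shift-fixpoint-unique : ∀ d {g f h : ℕ → ℕ} →
  f ≗ g ⊕ shift (suc d) f → h ≗ g ⊕ shift (suc d) h → f ≗ h
shift-fixpoint-unique d {g} {f} {h} f-fix h-fix = <-rec (λ n → f n ≡ h n) step
  where
  step : ∀ n → (∀ {m} → m < n → f m ≡ h m) → f n ≡ h n
  step n f≡h = begin
    f n                       ≡⟨ f-fix n ⟩
    g n + shift (suc d) f n   ≡⟨ cong (g n +_) (below n f≡h) ⟩
    g n + shift (suc d) h n   ≡⟨ h-fix n ⟨
    h n                       ∎
    where
    open ≡-Reasoning
    below : ∀ n → (∀ {m} → m < n → f m ≡ h m) → shift (suc d) f n ≡ shift (suc d) h n
    below zero    _   = refl
    below (suc n) f≡h = shift-cong-≤ d n (f≡h ∘ s≤s)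

module _ {P : Pred A ℓ₁} (P? : Decidable P) where

  count : List A → ℕ
  count xs = length (filter P? xs)

  count-++ : ∀ xs ys → count (xs ++ ys) ≡ count xs + count ys
  count-++ xs ys = trans (cong length (filter-++ P? xs ys)) (length-++ (filter P? xs))

  count-none : ∀ {xs} → All (∁ P) xs → count xs ≡ 0
  count-none none = cong length (filter-none P? none)

count-map : ∀ {B : Set ℓ₂} {P : Pred A ℓ₁} (P? : Decidable P) (f : B → A) xs →
            count P? (map f xs) ≡ count (P? ∘ f) xs
count-map P? f []       = refl
count-map P? f (x ∷ xs) with does (P? (f x))
... | true  = cong suc (count-map P? f xs)
... | false = count-map P? f xs

count-cong : {P : Pred A ℓ₁} {Q : Pred A ℓ₂} (P? : Decidable P) (Q? : Decidable Q) →
             ∀ {xs} → All (λ x → P x ⇔ Q x) xs → count P? xs ≡ count Q? xs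
count-cong P? Q? {[]}     []         = refl
count-cong P? Q? {x ∷ xs} (P⇔Q ∷ es) with P? x | Q? x
... | yes _  | yes _  = cong suc (count-cong P? Q? es)
... | no  _  | no  _  = count-cong P? Q? es
... | yes px | no ¬qx = contradiction (Equivalence.to P⇔Q px) ¬qx
... | no ¬px | yes qx = contradiction (Equivalence.from P⇔Q qx) ¬px

between? : ∀ c → Decidable (λ a → 1 ≤ a × a ≤ c)
between? c a = (1 ≤? a) ×-dec (a ≤? c)

filter-between-upTo : ∀ c j → filter (between? c) (upTo (suc j)) ≡ applyUpTo suc (c ⊓ j)
filter-between-upTo c zero    = cong (applyUpTo suc) (sym (⊓-zeroʳ c))
filter-between-upTo c (suc j) = begin
    filter (between? c) (upTo (suc (suc j)))
  ≡⟨ cong (filter (between? c)) (upTo-∷ʳ (suc j)) ⟨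
    filter (between? c) (upTo (suc j) ++ [ suc j ])
  ≡⟨ filter-++ (between? c) (upTo (suc j)) [ suc j ] ⟩
    filter (between? c) (upTo (suc j)) ++ filter (between? c) [ suc j ]
  ≡⟨ cong (_++ filter (between? c) [ suc j ]) (filter-between-upTo c j) ⟩
    applyUpTo suc (c ⊓ j) ++ filter (between? c) [ suc j ]
  ≡⟨ append-last (suc j ≤? c) ⟩
    applyUpTo suc (c ⊓ suc j) ∎
  where
  open ≡-Reasoning
  append-last : Dec (suc j ≤ c) → applyUpTo suc (c ⊓ j) ++ filter (between? c) [ suc j ] ≡ applyUpTo suc (c ⊓ suc j)
  append-last (yes j<c)
    rewrite filter-accept (between? c) {xs = []} (s≤s z≤n , j<c)
          | m≥n⇒m⊓n≡n (<⇒≤ j<c) | m≥n⇒m⊓n≡n j<c = applyUpTo-∷ʳ suc j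
  append-last (no j≮c)
    rewrite filter-reject (between? c) {xs = []} (j≮c ∘ proj₂)
          | m≤n⇒m⊓n≡m (≤-pred (≰⇒> j≮c)) | m≤n⇒m⊓n≡m (m≤n⇒m≤1+n (≤-pred (≰⇒> j≮c))) = ++-identityʳ _

partsLe-part? : ∀ k m → Decidable (λ a → 1 ≤ a × a ≤ k × a ≤ suc m)
partsLe-part? k m a = (1 ≤? a) ×-dec (a ≤? k) ×-dec (a ≤? suc m)

partsLe-parts : ∀ k m → filter (partsLe-part? k m) (upTo (suc (suc m))) ≡ map suc (upTo (k ⊓ suc m))
partsLe-parts k m = begin
    filter (partsLe-part? k m) (upTo (suc (suc m)))
  ≡⟨ filter-≐ (partsLe-part? k m) (between? c) (to , from) (upTo (suc (suc m))) ⟩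
    filter (between? c) (upTo (suc (suc m)))
  ≡⟨ filter-between-upTo c (suc m) ⟩
    applyUpTo suc (c ⊓ suc m)
  ≡⟨ cong (applyUpTo suc) (m≤n⇒m⊓n≡m (m⊓n≤n k (suc m))) ⟩
    applyUpTo suc c
  ≡⟨ map-upTo suc c ⟨
    map suc (upTo c) ∎
  where
  open ≡-Reasoning
  c = k ⊓ suc m
  to : ∀ {a} → 1 ≤ a × a ≤ k × a ≤ suc m → 1 ≤ a × a ≤ c
  to (1≤a , a≤k , a≤m) = 1≤a , ⊓-glb a≤k a≤m
  from : ∀ {a} → 1 ≤ a × a ≤ c → 1 ≤ a × a ≤ k × a ≤ suc m
  from (1≤a , a≤c) = 1≤a , ≤-trans a≤c (m⊓n≤m k (suc m)) , ≤-trans a≤c (m⊓n≤n k (suc m))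

partsLe-unfold : ∀ f k m → partsLe (suc f) k (suc m)
                 ≡ concatMap (λ b → map (suc b ∷_) (partsLe f (suc b) (m ∸ b))) (upTo (k ⊓ suc m))
partsLe-unfold f k m =
  trans (cong (concatMap _) (partsLe-parts k m)) (concatMap-map _ suc (upTo (k ⊓ suc m)))

partsLe-zero : ∀ f k → partsLe f k 0 ≡ [ [] ]
partsLe-zero zero    k = refl
partsLe-zero (suc f) k = refl

partsLe-fuel : ∀ f g k m → m ≤ f → m ≤ g → partsLe f k m ≡ partsLe g k m
partsLe-fuel f       g       k zero    _         _         = trans (partsLe-zero f k) (sym (partsLe-zero g k))
partsLe-fuel (suc f) (suc g) k (suc m) (s≤s m≤f) (s≤s m≤g) = begin
    partsLe (suc f) k (suc m)
  ≡⟨ partsLe-unfold f k m ⟩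
    concatMap (λ b → map (suc b ∷_) (partsLe f (suc b) (m ∸ b))) (upTo (k ⊓ suc m))
  ≡⟨ concatMap-cong (λ b → cong (map (suc b ∷_)) (refuel b)) (upTo (k ⊓ suc m)) ⟩
    concatMap (λ b → map (suc b ∷_) (partsLe g (suc b) (m ∸ b))) (upTo (k ⊓ suc m))
  ≡⟨ partsLe-unfold g k m ⟨
    partsLe (suc g) k (suc m) ∎
  where
  open ≡-Reasoning
  refuel : ∀ b → partsLe f (suc b) (m ∸ b) ≡ partsLe g (suc b) (m ∸ b)
  refuel b = partsLe-fuel f g (suc b) (m ∸ b) (≤-trans (m∸n≤m m b) m≤f) (≤-trans (m∸n≤m m b) m≤g)

partsLe-bounded : ∀ f k m → All (All (_≤ k)) (partsLe f k m)
partsLe-bounded zero    k zero    = [] ∷ []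
partsLe-bounded zero    k (suc m) = []
partsLe-bounded (suc f) k zero    = [] ∷ []
partsLe-bounded (suc f) k (suc m) =
  concat⁺ (map⁺ (All.map bounded (all-filter (partsLe-part? k m) (upTo (suc (suc m))))))
  where
  bounded : ∀ {a} → 1 ≤ a × a ≤ k × a ≤ suc m → All (All (_≤ k)) (map (a ∷_) (partsLe f a (suc m ∸ a)))
  bounded {a} (_ , a≤k , _) =
    map⁺ (All.map (λ ys≤a → a≤k ∷ All.map (λ b≤a → ≤-trans b≤a a≤k) ys≤a) (partsLe-bounded f a (suc m ∸ a)))

partitions≤ : ℕ → ℕ → List (List ℕ)
partitions≤ k m = partsLe m k m

partitions≤-bounded : ∀ k m → All (All (_≤ k)) (partitions≤ k m)
partitions≤-bounded k m = partsLe-bounded m k m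

partitions≤-suc : ∀ k m → partitions≤ k (suc m)
                  ≡ concatMap (λ b → map (suc b ∷_) (partitions≤ (suc b) (m ∸ b))) (upTo (k ⊓ suc m))
partitions≤-suc k m = trans (partsLe-unfold m k m) (concatMap-cong refuel (upTo (k ⊓ suc m)))
  where
  refuel : ∀ b → map (suc b ∷_) (partsLe m (suc b) (m ∸ b)) ≡ map (suc b ∷_) (partitions≤ (suc b) (m ∸ b))
  refuel b = cong (map (suc b ∷_)) (partsLe-fuel m (m ∸ b) (suc b) (m ∸ b) (m∸n≤m m b) ≤-refl)

partitions≤-peel : k < m → partitions≤ (suc k) m ≡ partitions≤ k m ++ map (suc k ∷_) (partitions≤ (suc k) (m ∸ suc k))
partitions≤-peel {k} {suc m} (s≤s k≤m) = begin
    partitions≤ (suc k) (suc m)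
  ≡⟨ partitions≤-suc (suc k) m ⟩
    concatMap F (upTo (suc k ⊓ suc m))
  ≡⟨ cong (concatMap F ∘ upTo) (m≤n⇒m⊓n≡m (s≤s k≤m)) ⟩
    concatMap F (upTo (suc k))
  ≡⟨ cong (concatMap F) (upTo-∷ʳ k) ⟨
    concatMap F (upTo k ++ [ k ])
  ≡⟨ concatMap-++ F (upTo k) [ k ] ⟩
    concatMap F (upTo k) ++ (F k ++ [])
  ≡⟨ cong₂ (λ c ys → concatMap F (upTo c) ++ ys) (sym (m≤n⇒m⊓n≡m (m≤n⇒m≤1+n k≤m))) (++-identityʳ (F k)) ⟩
    concatMap F (upTo (k ⊓ suc m)) ++ F k
  ≡⟨ cong (_++ F k) (partitions≤-suc k m) ⟨
    partitions≤ k (suc m) ++ F k ∎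
  where
  open ≡-Reasoning
  F : ℕ → List (List ℕ)
  F b = map (suc b ∷_) (partitions≤ (suc b) (m ∸ b))

partitions≤-suc-stable : m ≤ k → partitions≤ (suc k) m ≡ partitions≤ k m
partitions≤-suc-stable {zero}      _     = refl
partitions≤-suc-stable {suc m} {k} m<k = begin
    partitions≤ (suc k) (suc m)
  ≡⟨ partitions≤-suc (suc k) m ⟩
    concatMap F (upTo (suc k ⊓ suc m))
  ≡⟨ cong (concatMap F ∘ upTo) (trans (m≥n⇒m⊓n≡n (m≤n⇒m≤1+n m<k)) (sym (m≥n⇒m⊓n≡n m<k))) ⟩
    concatMap F (upTo (k ⊓ suc m))
  ≡⟨ partitions≤-suc k m ⟨
    partitions≤ k (suc m) ∎
  where
  open ≡-Reasoning
  F : ℕ → List (List ℕ)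
  F b = map (suc b ∷_) (partitions≤ (suc b) (m ∸ b))

partitions≤-stable : m ≤ k → partitions≤ k m ≡ partitions m
partitions≤-stable {k = zero}  z≤n = refl
partitions≤-stable {k = suc k} m≤k with m≤n⇒m<n∨m≡n m≤k
... | inj₁ m<k  = trans (partitions≤-suc-stable (≤-pred m<k)) (partitions≤-stable (≤-pred m<k))
... | inj₂ refl = refl

module _ {P : Pred (List ℕ) ℓ₁} (P? : Decidable P) where

  count≤ : ℕ → ℕ → ℕ
  count≤ k m = count P? (partitions≤ k m)

  count≤-none : (∀ {xs} → All (_≤ k) xs → ¬ P xs) → count≤ k ≗ const 0
  count≤-none {k} ¬P m = count-none P? (All.map ¬P (partitions≤-bounded k m))

count≤-stable : {P : Pred (List ℕ) 0ℓ} (P? : Decidable P) → m ≤ k → count≤ P? k m ≡ #Partitions P? m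
count≤-stable P? m≤k = cong (count P?) (partitions≤-stable m≤k)

count≤-cong : {P : Pred (List ℕ) ℓ₁} {Q : Pred (List ℕ) ℓ₂} (P? : Decidable P) (Q? : Decidable Q) →
              (∀ {xs} → All (_≤ k) xs → P xs ⇔ Q xs) → count≤ P? k ≗ count≤ Q? k
count≤-cong {k = k} P? Q? P⇔Q m = count-cong P? Q? (All.map P⇔Q (partitions≤-bounded k m))

count≤-suc : ∀ {P : Pred (List ℕ) ℓ₁} (P? : Decidable P) k →
             count≤ P? (suc k) ≗ count≤ P? k ⊕ shift (suc k) (count≤ (P? ∘ (suc k ∷_)) (suc k))
count≤-suc P? k m with suc k ≤? m
... | yes k<m = begin
    count P? (partitions≤ (suc k) m)
  ≡⟨ cong (count P?) (partitions≤-peel k<m) ⟩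
    count P? (partitions≤ k m ++ map (suc k ∷_) (partitions≤ (suc k) (m ∸ suc k)))
  ≡⟨ count-++ P? (partitions≤ k m) _ ⟩
    count≤ P? k m + count P? (map (suc k ∷_) (partitions≤ (suc k) (m ∸ suc k)))
  ≡⟨ cong (count≤ P? k m +_) (count-map P? (suc k ∷_) (partitions≤ (suc k) (m ∸ suc k))) ⟩
    count≤ P? k m + count≤ (P? ∘ (suc k ∷_)) (suc k) (m ∸ suc k)
  ≡⟨ cong (count≤ P? k m +_) (shift-≤ (suc k) k<m) ⟨
    count≤ P? k m + shift (suc k) (count≤ (P? ∘ (suc k ∷_)) (suc k)) m ∎
  where open ≡-Reasoning
... | no k≮m = begin
    count P? (partitions≤ (suc k) m)
  ≡⟨ cong (count P?) (partitions≤-suc-stable (≤-pred (≰⇒> k≮m))) ⟩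
    count≤ P? k m
  ≡⟨ +-identityʳ (count≤ P? k m) ⟨
    count≤ P? k m + 0
  ≡⟨ cong (count≤ P? k m +_) (shift-> (suc k) (≰⇒> k≮m)) ⟨
    count≤ P? k m + shift (suc k) (count≤ (P? ∘ (suc k ∷_)) (suc k)) m ∎
  where open ≡-Reasoning

count≤-suc-none : ∀ {P : Pred (List ℕ) ℓ₁} (P? : Decidable P) k →
                  (∀ {ys} → All (_≤ suc k) ys → ¬ P (suc k ∷ ys)) → count≤ P? (suc k) ≗ count≤ P? k
count≤-suc-none P? k ¬P m = begin
    count≤ P? (suc k) m
  ≡⟨ count≤-suc P? k m ⟩
    count≤ P? k m + shift (suc k) (count≤ (P? ∘ (suc k ∷_)) (suc k)) m
  ≡⟨ cong (count≤ P? k m +_) (trans (shift-cong (suc k) (count≤-none (P? ∘ (suc k ∷_)) ¬P) m) (shift-const-0 (suc k) m)) ⟩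
    count≤ P? k m + 0
  ≡⟨ +-identityʳ (count≤ P? k m) ⟩
    count≤ P? k m ∎
  where open ≡-Reasoning

parity : ∀ n → Even n ⊎ Odd n
parity zero          = inj₁ refl
parity (suc zero)    = inj₂ refl
parity (suc (suc n)) = parity n

even⇒¬odd : ∀ n → Even n → ¬ Odd n
even⇒¬odd _ even odd = 0≢1+n (trans (sym even) odd)

even⇒odd-suc : ∀ n → Even n → Odd (suc n)
even⇒odd-suc zero          _    = refl
even⇒odd-suc (suc (suc n)) even = even⇒odd-suc n even

noOddRepeated-∷-even : Even b → NoOddRepeated xs → NoOddRepeated (b ∷ xs)
noOddRepeated-∷-even {b} even r = All.universal (λ _ odd → contradiction odd (even⇒¬odd b even)) _ ∷ r

noOddRepeated-∷-larger : All (_< b) xs → NoOddRepeated xs → NoOddRepeated (b ∷ xs)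
noOddRepeated-∷-larger xs<b r = All.map (λ c<b _ b≡c → <-irrefl (sym b≡c) c<b) xs<b ∷ r

module _ {G : Pred ℕ 0ℓ} (G? : Decidable G) where

  podIn? : Decidable (λ xs → NoOddRepeated xs × All G xs)
  podIn? xs = noOddRepeated? xs ×-dec all? G? xs

  podIn≤ : ℕ → ℕ → ℕ
  podIn≤ = count≤ podIn?

  podIn≤-zero : podIn≤ 0 ≗ δ
  podIn≤-zero zero    = refl
  podIn≤-zero (suc m) = cong (count podIn?) (partitions≤-suc 0 m)

  podIn≤-suc-∉ : ¬ G (suc k) → podIn≤ (suc k) ≗ podIn≤ k
  podIn≤-suc-∉ {k} ∉G = count≤-suc-none podIn? k (λ { _ (_ , g ∷ _) → ∉G g })

  podIn≤-suc-even : Even (suc k) → G (suc k) → podIn≤ (suc k) ≗ podIn≤ k ⊕ shift (suc k) (podIn≤ (suc k))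
  podIn≤-suc-even {k} even g m =
    trans (count≤-suc podIn? k m) (cong (podIn≤ k m +_) (shift-cong (suc k) (count≤-cong _ podIn? (λ _ → drop-head)) m))
    where
    drop-head : ∀ {ys} → (NoOddRepeated (suc k ∷ ys) × All G (suc k ∷ ys)) ⇔ (NoOddRepeated ys × All G ys)
    drop-head = mk⇔ (λ { (_ ∷ r , _ ∷ gs) → r , gs }) (λ (r , gs) → noOddRepeated-∷-even even r , g ∷ gs)

  podIn≤-suc-odd : Odd (suc k) → G (suc k) → podIn≤ (suc k) ≗ podIn≤ k ⊕ shift (suc k) (podIn≤ k)
  podIn≤-suc-odd {k} odd g m =
    trans (count≤-suc podIn? k m) (cong (podIn≤ k m +_) (shift-cong (suc k) head-once m))
    where
    drop-head : ∀ {ys} → All (_≤ k) ys →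
                (NoOddRepeated (suc k ∷ ys) × All G (suc k ∷ ys)) ⇔ (NoOddRepeated ys × All G ys)
    drop-head ys≤k = mk⇔ (λ { (_ ∷ r , _ ∷ gs) → r , gs })
                         (λ (r , gs) → noOddRepeated-∷-larger (All.map s≤s ys≤k) r , g ∷ gs)
    head-once : count≤ (podIn? ∘ (suc k ∷_)) (suc k) ≗ podIn≤ k
    head-once r = trans (count≤-suc-none _ k (λ { _ (((k≢k ∷ _) ∷ _) , _) → k≢k odd refl }) r)
                        (count≤-cong _ podIn? drop-head r)

pod≤ : ℕ → ℕ → ℕ
pod≤ = podIn≤ U?

pod>2≤ : ℕ → ℕ → ℕ
pod>2≤ = podIn≤ (2 <?_)

pod : ℕ → ℕ
pod = #Partitions (podIn? U?)

O2≤ : ℕ → ℕ → ℕ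
O2≤ = count≤ O2?

O2≤-zero : O2≤ 0 ≗ const 0
O2≤-zero zero    = refl
O2≤-zero (suc m) = cong (count O2?) (partitions≤-suc 0 m)

O2≤-suc-odd : Odd (suc k) → O2≤ (suc k) ≗ O2≤ k
O2≤-suc-odd {k} odd = count≤-suc-none O2? k not-largest
  where
  not-largest : ∀ {ys} → All (_≤ suc k) ys → ¬ (NoOddRepeated (suc k ∷ ys) × LargestEvenTwice (suc k ∷ ys))
  not-largest {[]}    _ (_ , ())
  not-largest {_ ∷ _} _ (_ , even , _) = even⇒¬odd (suc k) even odd

O2≤-suc-even : Even (suc k) → O2≤ (suc k) ≗ O2≤ k ⊕ shift (suc k) (shift (suc k) (pod≤ (suc k)))
O2≤-suc-even {k} even m = trans (count≤-suc O2? k m) (cong (O2≤ k m +_) (shift-cong (suc k) largest-twice m))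
  where
  not-largest : ∀ {ys} → All (_≤ k) ys → ¬ (NoOddRepeated (suc k ∷ ys) × LargestEvenTwice (suc k ∷ ys))
  not-largest {[]}    _           (_ , ())
  not-largest {_ ∷ _} (b≤k ∷ _) (_ , _ , k≡b) = <-irrefl (sym k≡b) (s≤s b≤k)
  drop-heads : ∀ {zs} → (NoOddRepeated (suc k ∷ suc k ∷ zs) × LargestEvenTwice (suc k ∷ suc k ∷ zs))
                        ⇔ (NoOddRepeated zs × All U zs)
  drop-heads = mk⇔ (λ { (_ ∷ _ ∷ r , _) → r , All.universal (const tt) _ })
                   (λ (r , _) → noOddRepeated-∷-even even (noOddRepeated-∷-even even r) , even , refl)
  largest-twice : count≤ (O2? ∘ (suc k ∷_)) (suc k) ≗ shift (suc k) (pod≤ (suc k))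
  largest-twice r = trans (count≤-suc _ k r)
    (cong₂ _+_ (count≤-none _ not-largest r) (shift-cong (suc k) (count≤-cong _ (podIn? U?) (λ _ → drop-heads)) r))

pod≤-2 : pod≤ 2 ≗ const 1
pod≤-2 = shift-fixpoint-unique 1 pod≤-2-fix const-1-fix
  where
  pod≤-1 : pod≤ 1 ≗ δ ⊕ shift 1 δ
  pod≤-1 m = trans (podIn≤-suc-odd U? refl tt m) (cong₂ _+_ (podIn≤-zero U? m) (shift-cong 1 (podIn≤-zero U?) m))
  pod≤-2-fix : pod≤ 2 ≗ (δ ⊕ shift 1 δ) ⊕ shift 2 (pod≤ 2)
  pod≤-2-fix m = trans (podIn≤-suc-even U? refl tt m) (cong (_+ shift 2 (pod≤ 2) m) (pod≤-1 m))
  const-1-fix : const 1 ≗ (δ ⊕ shift 1 δ) ⊕ shift 2 (const 1)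
  const-1-fix zero          = refl
  const-1-fix (suc zero)    = refl
  const-1-fix (suc (suc m)) = refl

pod>2≤-2 : pod>2≤ 2 ≗ δ
pod>2≤-2 m = begin
  pod>2≤ 2 m ≡⟨ podIn≤-suc-∉ (2 <?_) (λ { (s≤s (s≤s ())) }) m ⟩
  pod>2≤ 1 m ≡⟨ podIn≤-suc-∉ (2 <?_) (λ { (s≤s ()) }) m ⟩
  pod>2≤ 0 m ≡⟨ podIn≤-zero (2 <?_) m ⟩
  δ m        ∎
  where open ≡-Reasoning

pod≤-split : ∀ j → pod≤ (2 + j) ≗ pod>2≤ (2 + j) ⊕ shift 1 (pod≤ (2 + j))
pod≤-split zero m = begin
  pod≤ 2 m                                ≡⟨ pod≤-2 m ⟩
  1                                       ≡⟨ base m ⟩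
  δ m + shift 1 (const 1) m               ≡⟨ cong₂ _+_ (pod>2≤-2 m) (shift-cong 1 pod≤-2 m) ⟨
  pod>2≤ 2 m + shift 1 (pod≤ 2) m         ∎
  where
  open ≡-Reasoning
  base : ∀ m → 1 ≡ δ m + shift 1 (const 1) m
  base zero    = refl
  base (suc m) = refl
pod≤-split (suc j) = by-parity (parity a)
  where
  open ≡-Reasoning
  i = 2 + j
  a = 3 + j
  N = pod≤
  M = pod>2≤
  2<a : 2 < a
  2<a = s≤s (s≤s (s≤s z≤n))
  split-fix : Even a → M a ⊕ shift 1 (N a) ≗ N i ⊕ shift a (M a ⊕ shift 1 (N a))
  split-fix even m = begin
      M a m + shift 1 (N a) m
    ≡⟨ cong₂ _+_ (podIn≤-suc-even (2 <?_) even 2<a m) (trans (shift-cong 1 (podIn≤-suc-even U? even tt) m) (shift-⊕ 1 m)) ⟩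
      (M i m + shift a (M a) m) + (shift 1 (N i) m + shift 1 (shift a (N a)) m)
    ≡⟨ interchange (M i m) _ _ _ ⟩
      (M i m + shift 1 (N i) m) + (shift a (M a) m + shift 1 (shift a (N a)) m)
    ≡⟨ cong₂ _+_ (pod≤-split j m) (cong (shift a (M a) m +_) (shift-comm a 1 m)) ⟨
      N i m + (shift a (M a) m + shift a (shift 1 (N a)) m)
    ≡⟨ cong (N i m +_) (shift-⊕ a m) ⟨
      N i m + shift a (M a ⊕ shift 1 (N a)) m ∎
  by-parity : Even a ⊎ Odd a → N a ≗ M a ⊕ shift 1 (N a)
  by-parity (inj₁ even) = shift-fixpoint-unique i (podIn≤-suc-even U? even tt) (split-fix even)
  by-parity (inj₂ odd) m = begin
      N a m
    ≡⟨ podIn≤-suc-odd U? odd tt m ⟩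
      N i m + shift a (N i) m
    ≡⟨ cong₂ _+_ (pod≤-split j m) (trans (shift-cong a (pod≤-split j) m) (shift-⊕ a m)) ⟩
      (M i m + shift 1 (N i) m) + (shift a (M i) m + shift a (shift 1 (N i)) m)
    ≡⟨ interchange (M i m) _ _ _ ⟩
      (M i m + shift a (M i) m) + (shift 1 (N i) m + shift a (shift 1 (N i)) m)
    ≡⟨ cong₂ _+_ (podIn≤-suc-odd (2 <?_) odd 2<a m) (cong (shift 1 (N i) m +_) (shift-comm 1 a m)) ⟨
      M a m + (shift 1 (N i) m + shift 1 (shift a (N i)) m)
    ≡⟨ cong (M a m +_) (trans (shift-cong 1 (podIn≤-suc-odd U? odd tt) m) (shift-⊕ 1 m)) ⟨
      M a m + shift 1 (N a) m ∎

pod≤-suc-suc : ∀ E → Even E →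
  pod≤ (2 + E) ≗ pod≤ E ⊕ shift (1 + E) (pod≤ E) ⊕ shift (2 + E) (pod≤ (2 + E))
pod≤-suc-suc E even m = trans (podIn≤-suc-even U? even tt m)
  (cong (_+ shift (2 + E) (pod≤ (2 + E)) m) (podIn≤-suc-odd U? (even⇒odd-suc E even) tt m))

O2≤-suc-suc : ∀ E → Even E → O2≤ (2 + E) ≗ O2≤ E ⊕ shift ((2 + E) + (2 + E)) (pod≤ (2 + E))
O2≤-suc-suc E even m = trans (O2≤-suc-even even m)
  (cong₂ _+_ (O2≤-suc-odd (even⇒odd-suc E even) m) (shift-shift (2 + E) (2 + E) m))

O2≤-Identity : ℕ → Set
O2≤-Identity E = O2≤ E ⊕ shift 3 (O2≤ E) ⊕ δ ⊕ shift 3 δ ⊕ shift 1 (pod≤ E)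
                 ≗ pod≤ E ⊕ shift (suc E) (pod≤ E) ⊕ shift (3 + (E + E)) (pod≤ E)

O2≤-identity-0 : O2≤-Identity 0
O2≤-identity-0 n = begin
    O2≤ 0 n + shift 3 (O2≤ 0) n + δ n + shift 3 δ n + shift 1 (pod≤ 0) n
  ≡⟨ cong₂ (λ x y → x + y + δ n + shift 3 δ n + shift 1 (pod≤ 0) n)
           (O2≤-zero n) (trans (shift-cong 3 O2≤-zero n) (shift-const-0 3 n)) ⟩
    δ n + shift 3 δ n + shift 1 (pod≤ 0) n
  ≡⟨ xy∙z≈xz∙y (δ n) _ _ ⟩
    δ n + shift 1 (pod≤ 0) n + shift 3 δ n
  ≡⟨ cong₂ (λ x y → x + shift 1 (pod≤ 0) n + y) (podIn≤-zero U? n) (shift-cong 3 (podIn≤-zero U?) n) ⟨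
    pod≤ 0 n + shift 1 (pod≤ 0) n + shift 3 (pod≤ 0) n ∎
  where open ≡-Reasoning

O2≤-identity-step : ∀ E → Even E → O2≤-Identity E → O2≤-Identity (2 + E)
O2≤-identity-step E even identity n = begin
    O2≤ a n + shift 3 (O2≤ a) n + δ n + shift 3 δ n + shift 1 Q n
  ≡⟨ cong₂ (λ x y → x + y + δ n + shift 3 δ n + shift 1 Q n)
           (O2≤-suc-suc E even n) (trans (shift-cong 3 (O2≤-suc-suc E even) n) (shift-⊕-shift 3 (a + a) n)) ⟩
    (O n + Q₄ n) + (shift 3 O n + Q₇ n) + δ n + shift 3 δ n + shift 1 Q n
  ≡⟨ cong ((O n + Q₄ n) + (shift 3 O n + Q₇ n) + δ n + shift 3 δ n +_) (shift-Q 1 n) ⟩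
    (O n + Q₄ n) + (shift 3 O n + Q₇ n) + δ n + shift 3 δ n + (shift 1 P n + P₁ n + Q₂ n)
  ≡⟨ regroup-lhs (O n) (Q₄ n) (shift 3 O n) (Q₇ n) (δ n) (shift 3 δ n) (shift 1 P n) (P₁ n) (Q₂ n) ⟩
    (O n + shift 3 O n + δ n + shift 3 δ n + shift 1 P n) + (P₁ n + Q₂ n + Q₄ n + Q₇ n)
  ≡⟨ cong (_+ (P₁ n + Q₂ n + Q₄ n + Q₇ n)) (identity n) ⟩
    (P n + shift c P n + shift (3 + (E + E)) P n) + (P₁ n + Q₂ n + Q₄ n + Q₇ n)
  ≡⟨ regroup-rhs (P n) (shift c P n) (shift (3 + (E + E)) P n) (P₁ n) (Q₂ n) (Q₄ n) (Q₇ n) ⟩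
    (P n + shift c P n + (P₁ n + shift (3 + (E + E)) P n + Q₄ n)) + Q₂ n + Q₇ n
  ≡⟨ cong (λ d → (P n + shift c P n + (P₁ n + shift (suc (suc d)) P n + Q₄ n)) + Q₂ n + Q₇ n) (+-suc E E) ⟨
    (P n + shift c P n + (P₁ n + shift (a + c) P n + Q₄ n)) + Q₂ n + Q₇ n
  ≡⟨ cong (λ x → (P n + shift c P n + x) + Q₂ n + Q₇ n) (shift-Q a n) ⟨
    (P n + shift c P n + shift a Q n) + Q₂ n + Q₇ n
  ≡⟨ cong (λ x → x + Q₂ n + Q₇ n) (shift-Q 0 n) ⟨
    Q n + shift (suc a) Q n + shift (3 + (a + a)) Q n ∎
  where
  open ≡-Reasoning
  c = 1 + E
  a = 2 + E
  P = pod≤ E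
  Q = pod≤ a
  O = O2≤ E
  P₁ = shift a P
  Q₂ = shift (suc a) Q
  Q₄ = shift (a + a) Q
  Q₇ = shift (3 + (a + a)) Q
  shift-Q : ∀ e → shift e Q ≗ shift e P ⊕ shift (e + c) P ⊕ shift (e + a) Q
  shift-Q e m = trans (shift-cong e (pod≤-suc-suc E even) m)
    (trans (shift-⊕-shift e a m) (cong (_+ shift (e + a) Q m) (shift-⊕-shift e c m)))
  regroup-lhs : ∀ o q₄ o₃ q₇ d d₃ p₀ p₁ q₂ →
    (o + q₄) + (o₃ + q₇) + d + d₃ + (p₀ + p₁ + q₂) ≡ (o + o₃ + d + d₃ + p₀) + (p₁ + q₂ + q₄ + q₇)
  regroup-lhs = solve-∀
  regroup-rhs : ∀ x y z p₁ q₂ q₄ q₇ →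
    (x + y + z) + (p₁ + q₂ + q₄ + q₇) ≡ (x + y + (p₁ + z + q₄)) + q₂ + q₇
  regroup-rhs = solve-∀

O2≤-identity : ∀ E → Even E → O2≤-Identity E
O2≤-identity zero          _    = O2≤-identity-0
O2≤-identity (suc (suc E)) even = O2≤-identity-step E even (O2≤-identity E even)

pod-suc : ∀ n → pod (suc n) ≡ pod>2 (suc n) + pod n
pod-suc n = begin
    pod (suc n)
  ≡⟨ count≤-stable (podIn? U?) (n≤1+n (suc n)) ⟨
    pod≤ (2 + n) (suc n)
  ≡⟨ pod≤-split n (suc n) ⟩
    pod>2≤ (2 + n) (suc n) + pod≤ (2 + n) n
  ≡⟨ cong₂ _+_ (count≤-stable (podIn? (2 <?_)) (n≤1+n (suc n))) (count≤-stable (podIn? U?) (m≤n+m n 2)) ⟩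
    pod>2 (suc n) + pod n ∎
  where open ≡-Reasoning

O2-pod-identity : ∀ n → 3 < n → O2 n + O2 (n ∸ 3) + pod (n ∸ 1) ≡ pod n
O2-pod-identity n (s≤s (s≤s (s≤s (s≤s _)))) = begin
    O2 n + O2 (n ∸ 3) + pod (n ∸ 1)
  ≡⟨ cong₂ _+_ (cong₂ _+_ (count≤-stable O2? n≤E) (count≤-stable O2? (≤-trans (m∸n≤m n 3) n≤E)))
               (count≤-stable (podIn? U?) (≤-trans (m∸n≤m n 1) n≤E)) ⟨
    O2≤ E n + O2≤ E (n ∸ 3) + pod≤ E (n ∸ 1)
  ≡⟨ cong (_+ pod≤ E (n ∸ 1)) (trans (+-identityʳ _) (+-identityʳ _)) ⟨
    O2≤ E n + shift 3 (O2≤ E) n + δ n + shift 3 δ n + shift 1 (pod≤ E) n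
  ≡⟨ O2≤-identity E (m*n%n≡0 n 2) n ⟩
    pod≤ E n + shift (suc E) (pod≤ E) n + shift (3 + (E + E)) (pod≤ E) n
  ≡⟨ cong₂ (λ x y → pod≤ E n + x + y) (shift-> (suc E) (s≤s n≤E)) (shift-> (3 + (E + E)) n<3+E+E) ⟩
    pod≤ E n + 0 + 0
  ≡⟨ trans (+-identityʳ _) (+-identityʳ _) ⟩
    pod≤ E n
  ≡⟨ count≤-stable (podIn? U?) n≤E ⟩
    pod n ∎
  where
  open ≡-Reasoning
  E = n * 2
  n≤E : n ≤ E
  n≤E = m≤m*n n 2
  n<3+E+E : n < 3 + (E + E)
  n<3+E+E = s≤s (≤-trans n≤E (≤-trans (m≤m+n E E) (m≤n+m (E + E) 2)))

theorem1p5 : ∀ (n : ℕ) → 4 < n → O2 n + O2 (n ∸ 3) ≡ pod>2 n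
theorem1p5 (suc n) 4<n =
  +-cancelʳ-≡ (pod n) _ _ (trans (O2-pod-identity (suc n) (<⇒≤ 4<n)) (pod-suc n))
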